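{- It is not the case that $\{X_i,X_{i+f}\}=\{\mathbf{A},\mathbf{B}\}$ for all $i\in[\![0,f-1]\!]$.
   Context: Let $p$ be a prime, $F/\mathbb{Q}_p$ finite unramified of degree $f\ge2$, $q=p^f$, $e=p^f-1$, $\nu=p+\dots+p^{f-1}$, $F'$ the unramified quadratic extension of $F$, $E$ a finite extension of $\mathbb{Q}_p$ containing $F'$, with ring of integers $\mathcal{O}_E$ and residue field $k_E$. Fix $\tau_0:F\to E$. Let $L=F(\varpi)$ with $\varpi^e=-p$, $\omega_f:\mathrm{Gal}(L/F)\cong k_F^\times$, $g\mapsto g(\varpi)/\varpi\bmod p$; for $c\in\mathbb{Z}/e\mathbb{Z}$, $\tau_0^c$ denotes $(\tau_0\circ\omega_f)^c$. Let $\omega_{2f}$ be the fundamental character of level $2f$ of $G_{F'}$, $\mathrm{nr}'(\theta)$ an unramified character of $G_{F'}$, $\omega$ the mod $p$ cyclotomic character. Let $h$ be an integer not divisible by $q+1$ and $\bar\rho=\mathrm{Ind}_{G_{F'}}^{G_F}(\omega_{2f}^h\mathrm{nr}'(\theta))$. Let $\eta\ne\eta':I_F\to\mathcal{O}_E^\times$ be tame characters of level $f$ extending to $G_F$ with reductions $\bar\eta=\tau_0^\gamma$, $\bar\eta'=\tau_0^{\gamma'}$, and assume $\det\bar\rho|_{I_F}=\bar\eta\bar\eta'\omega|_{I_F}$. Gene: let $h_0,\dots,h_{f-1}\in[\![0,p-1]\!]$ with $h\equiv1+\sum_{i=0}^{f-1}h_ip^{f-1-i}\pmod{q+1}$, $h_i=p-1-h_{i-f}$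 for $f\le i<2f$, extended $2f$-periodically; $\varepsilon_i=1$ if $h_i=p-1$, else $0$. Let $\alpha_i\in[\![0,e-1]\!]$ with $\alpha_i\equiv\lfloor p^ih/(q+1)\rfloor-p^i\gamma'\pmod e$ (extended $2f$-periodically). $X_i=\mathbf{A}$ if $0\le\alpha_i<\nu/p+\varepsilon_{i+f}$; $\mathbf{AB}$ if $\nu/p+\varepsilon_{i+f}\le\alpha_i\le\frac{p-1}{p}\nu-\varepsilon_i$; $\mathbf{B}$ if $\frac{p-1}{p}\nu-\varepsilon_i<\alpha_i\le\nu$; $\mathbf{0}$ if $\alpha_i>\nu$. -}

module Defs where

open import Data.Nat as ℕ using (ℕ; zero; suc; _∸_; _^_; _<ᵇ_; _≡ᵇ_)
open import Data.Nat.DivMod using (_%_)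
open import Data.Integer as ℤ using (ℤ; +_; _-_; _*_; _+_; _/ℕ_; _<?_; _≤?_)
open import Data.Bool using (if_then_else_)
open import Data.Product using (_×_)
open import Data.Sum using (_⊎_)
open import Relation.Nullary.Decidable using (does)
open import Relation.Binary.PropositionalEquality using (_≡_)

sumBelow : ℕ → (ℕ → ℕ) → ℕ
sumBelow zero    g = 0
sumBelow (suc n) g = sumBelow n g ℕ.+ g n

qq : ℕ → ℕ → ℕ
qq p f = p ^ f

ee : ℕ → ℕ → ℕ
ee p f = qq p f ∸ 1

nu : ℕ → ℕ → ℕ
nu p f = sumBelow (f ∸ 1) (λ j → p ^ suc j)

digitValue : ℕ → ℕ → (ℕ → ℕ) → ℕ
digitValue p f hd = sumBelow f (λ i → hd i ℕ.* p ^ (f ∸ 1 ∸ i))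

-- i mod 2f  (identity when f = 0, never used then)
mod2f : ℕ → ℕ → ℕ
mod2f zero     i = i
mod2f (suc f') i = i % (2 ℕ.* suc f')

-- h_i for all i ∈ ℕ: h_i given for i < f, h_i = p-1-h_{i-f} for f ≤ i < 2f,
-- extended 2f-periodically
hExt : ℕ → ℕ → (ℕ → ℕ) → ℕ → ℕ
hExt p f hd i =
  let j = mod2f f i in
  if j <ᵇ f then hd j else (p ∸ 1) ∸ hd (j ∸ f)

eps : ℕ → ℕ → (ℕ → ℕ) → ℕ → ℕ
eps p f hd i = if hExt p f hd i ≡ᵇ (p ∸ 1) then 1 else 0

-- ⌊ p^i h / (q+1) ⌋  (Euclidean division by a positive integer = floor)
floorTerm : ℕ → ℕ → ℤ → ℕ → ℤ
floorTerm p f h i = (+ (p ^ i) * h) /ℕ suc (qq p f)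

data Region : Set where
  A AB B Zero : Region

-- X_i, given α (on [0,2f), extended 2f-periodically).  The comparisons
-- with ν/p and ((p-1)/p)ν are written after multiplying through by p > 0:
--   α < ν/p + ε_{i+f}          ⇔  p α < ν + p ε_{i+f}
--   α ≤ ((p-1)/p) ν - ε_i      ⇔  p α ≤ (p-1) ν - p ε_i
X : ℕ → ℕ → (ℕ → ℕ) → (ℕ → ℤ) → ℕ → Region
X p f hd α i =
  let a  = α (mod2f f i)
      P  = + p
      V  = + nu p f
      e₁ = + eps p f hd (i ℕ.+ f)
      e₀ = + eps p f hd i
  in if does (P * a <? V + P * e₁) then A
     else if does (P * a ≤? (+ (p ∸ 1)) * V - P * e₀) then AB
     else if does (a ≤? V) then B
     else Zero

PairIsAB : Region → Region → Set
PairIsAB x y = (x ≡ A × y ≡ B) ⊎ (x ≡ B × y ≡ A)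

module Submission where

-- Write p = 2 + p₂, f = 1 + f₁ and m = 1 + p + ... + p^(f-2), so that ν = p m and
-- e = q - 1 = (p - 1)(ν + 1), and put x_j = α_j + α_(j+f) - ν.  The argument has four steps.
--  1. Digits.  For k ≤ f, p^k h = N_k (q + 1) + r_k where N_k = p^k t + (h₀…h_(k-1) in base p) and
--     0 < r_k ≤ q; hence ⌊p^k h/(q+1)⌋ = N_k and ⌊p^(k+f) h/(q+1)⌋ = p^k h - 1 - N_k.  The
--     representatives β_i = ⌊p^i h/(q+1)⌋ - p^i γ′ of α_i therefore obey β_(i+1) = p β_i + h_i
--     inside each half [0, f) and [f, 2f), and β₀ + β_f = h - 1 - (q + 1) γ′.
--  2. Congruences.  Since h_j + h_(j+f) = p - 1, x_(j+1) ≡ p x_j (mod e); and x₀ ≡ γ - γ′ ≢ 0.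
--  3. Windows.  {X_j, X_(j+f)} = {A, B} gives |x_j| ≤ m; for two consecutive such j this forces
--     x_(j+1) = p x_j, for p ≥ 3 because (p + 1) m < e, for p = 2 by the exact recursions of α.
--  4. So x_(f-1) = p^(f-1) x₀ with |x_(f-1)| ≤ m < p^(f-1), whence x₀ = 0, a contradiction.
-- The file develops arithmetic on ℕ (geometric sums, base-p digits), then integer arithmetic
-- (inequalities certified by explicit nonnegative slacks, floors, the window and doubling
-- estimates), and finally carries out steps 1-4 in modules fixing p, f and the data of the lemma.

open import Defs

module NaturalArithmetic where

  open import Data.Nat
  open import Data.Nat.Properties
  open import Data.Nat.Tactic.RingSolver using (solve-∀)
  open import Data.Product using (Σ; _×_; _,_)
  open import Relation.Binary.PropositionalEquality

  sumBelow-scale : ∀ c n (g : ℕ → ℕ) → sumBelow n (λ j → c * g j) ≡ c * sumBelow n g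
  sumBelow-scale c zero    g = sym (*-zeroʳ c)
  sumBelow-scale c (suc n) g =
    trans (cong (_+ c * g n) (sumBelow-scale c n g)) (sym (*-distribˡ-+ c (sumBelow n g) (g n)))

  geomSum : ℕ → ℕ → ℕ
  geomSum p n = sumBelow n (p ^_)

  geomSum-closed : ∀ p₁ n → p₁ * geomSum (suc p₁) n + 1 ≡ suc p₁ ^ n
  geomSum-closed p₁ zero    = cong (_+ 1) (*-zeroʳ p₁)
  geomSum-closed p₁ (suc n) = begin
    p₁ * (geomSum p n + p ^ n) + 1      ≡⟨ regroup p₁ (geomSum p n) (p ^ n) ⟩
    (p₁ * geomSum p n + 1) + p₁ * p ^ n ≡⟨ cong (_+ p₁ * p ^ n) (geomSum-closed p₁ n) ⟩
    p ^ n + p₁ * p ^ n                  ∎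
    where
    open ≡-Reasoning
    p : ℕ
    p = suc p₁
    regroup : ∀ a g x → a * (g + x) + 1 ≡ (a * g + 1) + a * x
    regroup = solve-∀

  geomSum-horner : ∀ p n → geomSum p (suc n) ≡ p * geomSum p n + 1
  geomSum-horner p zero    = cong (_+ 1) (sym (*-zeroʳ p))
  geomSum-horner p (suc n) = begin
    geomSum p (suc n) + p ^ suc n   ≡⟨ cong (_+ p ^ suc n) (geomSum-horner p n) ⟩
    p * geomSum p n + 1 + p * p ^ n ≡⟨ regroup p (geomSum p n) (p ^ n) ⟩
    p * (geomSum p n + p ^ n) + 1   ∎
    where
    open ≡-Reasoning
    regroup : ∀ a g x → a * g + 1 + a * x ≡ a * (g + x) + 1
    regroup = solve-∀

  geomSum<pow : ∀ p₂ n → geomSum (2 + p₂) n < (2 + p₂) ^ n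
  geomSum<pow p₂ n = subst (G <_) (geomSum-closed (suc p₂) n)
    (<-≤-trans (m<m+n G (s≤s z≤n)) (+-monoˡ-≤ 1 (m≤m+n G (p₂ * G))))
    where
    G : ℕ
    G = geomSum (2 + p₂) n

  nu≡ : ∀ p f → nu p f ≡ p * geomSum p (f ∸ 1)
  nu≡ p f = sumBelow-scale p (f ∸ 1) (p ^_)

  ee≡ : ∀ p₁ f₁ → ee (suc p₁) (suc f₁) ≡ p₁ * (nu (suc p₁) (suc f₁) + 1)
  ee≡ p₁ f₁ = begin
    p ^ suc f₁ ∸ 1                  ≡⟨ cong (_∸ 1) (sym (geomSum-closed p₁ (suc f₁))) ⟩
    p₁ * geomSum p (suc f₁) + 1 ∸ 1 ≡⟨ m+n∸n≡m _ 1 ⟩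
    p₁ * geomSum p (suc f₁)         ≡⟨ cong (p₁ *_) (geomSum-horner p f₁) ⟩
    p₁ * (p * geomSum p f₁ + 1)     ≡⟨ cong (λ v → p₁ * (v + 1)) (sym (nu≡ p (suc f₁))) ⟩
    p₁ * (nu p (suc f₁) + 1)        ∎
    where
    open ≡-Reasoning
    p : ℕ
    p = suc p₁

  prefix : ℕ → (ℕ → ℕ) → ℕ → ℕ
  prefix p d zero    = 0
  prefix p d (suc k) = p * prefix p d k + d k

  prefix-split : ∀ p d k n → prefix p d (k + n) ≡ prefix p d k * p ^ n + prefix p (λ i → d (k + i)) n
  prefix-split p d k zero    =
    trans (cong (prefix p d) (+-identityʳ k)) (sym (trans (+-identityʳ _) (*-identityʳ _)))
  prefix-split p d k (suc n) = begin
    prefix p d (k + suc n)             ≡⟨ cong (prefix p d) (+-suc k n) ⟩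
    p * prefix p d (k + n) + d (k + n) ≡⟨ cong (λ z → p * z + d (k + n)) (prefix-split p d k n) ⟩
    p * (T * p ^ n + S) + d (k + n)    ≡⟨ regroup p T (p ^ n) S (d (k + n)) ⟩
    T * (p * p ^ n) + (p * S + d (k + n)) ∎
    where
    open ≡-Reasoning
    T S : ℕ
    T = prefix p d k
    S = prefix p (λ i → d (k + i)) n
    regroup : ∀ a t x s y → a * (t * x + s) + y ≡ t * (a * x) + (a * s + y)
    regroup = solve-∀

  prefix<pow : ∀ p₁ d n → (∀ i → i < n → d i ≤ p₁) → prefix (suc p₁) d n < suc p₁ ^ n
  prefix<pow p₁ d zero    _    = s≤s z≤n
  prefix<pow p₁ d (suc n) d≤p₁ = begin-strict
    p * T + d n  <⟨ +-monoʳ-< (p * T) (s≤s (d≤p₁ n ≤-refl)) ⟩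
    p * T + p    ≡⟨ sym (trans (*-suc p T) (+-comm p (p * T))) ⟩
    p * suc T    ≤⟨ *-monoʳ-≤ p (prefix<pow p₁ d n (λ i i<n → d≤p₁ i (m<n⇒m<1+n i<n))) ⟩
    p * p ^ n    ∎
    where
    open ≤-Reasoning
    p T : ℕ
    p = suc p₁
    T = prefix p d n

  digitSum-prefix : ∀ p f d k n → k + n ≡ f →
    sumBelow k (λ i → d i * p ^ (f ∸ 1 ∸ i)) ≡ prefix p d k * p ^ n
  digitSum-prefix p f d zero    n _       = refl
  digitSum-prefix p f d (suc k) n k+1+n≡f = begin
    sumBelow k D + d k * p ^ (f ∸ 1 ∸ k) ≡⟨ cong₂ (λ s i → s + d k * p ^ i) earlier exponent ⟩
    T * (p * p ^ n) + d k * p ^ n        ≡⟨ regroup p T (p ^ n) (d k) ⟩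
    (p * T + d k) * p ^ n                ∎
    where
    open ≡-Reasoning
    D : ℕ → ℕ
    D i = d i * p ^ (f ∸ 1 ∸ i)
    T : ℕ
    T = prefix p d k
    earlier : sumBelow k D ≡ T * (p * p ^ n)
    earlier = digitSum-prefix p f d k (suc n) (trans (+-suc k n) k+1+n≡f)
    exponent : f ∸ 1 ∸ k ≡ n
    exponent = trans (cong (λ z → z ∸ 1 ∸ k) (sym k+1+n≡f)) (m+n∸m≡n k n)
    regroup : ∀ a t x y → t * (a * x) + y * x ≡ (a * t + y) * x
    regroup = solve-∀

  digitValue≡prefix : ∀ p f d → digitValue p f d ≡ prefix p d f
  digitValue≡prefix p f d =
    trans (digitSum-prefix p f d f 0 (+-identityʳ f)) (*-identityʳ (prefix p d f))

  -- Division of p^k (1 + h₀…h_(f-1)) by p^f + 1 for k ≤ f: the quotient is the k-digit prefix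
  -- and the remainder r satisfies 0 < r ≤ p^f.  This is the digit description of ⌊p^k h/(q+1)⌋.
  digit-division : ∀ p₁ f d → (∀ i → i < f → d i ≤ p₁) → ∀ k n → k + n ≡ f →
    let p = suc p₁ in
    Σ ℕ λ r → (p ^ k * (1 + prefix p d f) ≡ prefix p d k * suc (p ^ f) + r) × 0 < r × r ≤ p ^ f
  digit-division p₁ f d d≤p₁ k n k+n≡f = r , division , 0<r , r≤q
    where
    p T R r : ℕ
    p = suc p₁
    T = prefix p d k
    R = prefix p (λ i → d (k + i)) n
    r = p ^ k * suc R ∸ T
    T<p^k : T < p ^ k
    T<p^k = prefix<pow p₁ d k (λ i i<k → d≤p₁ i (<-≤-trans i<k (subst (k ≤_) k+n≡f (m≤m+n k n))))
    R<p^n : R < p ^ n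
    R<p^n = prefix<pow p₁ (λ i → d (k + i)) n
              (λ i i<n → d≤p₁ (k + i) (subst (k + i <_) k+n≡f (+-monoʳ-< k i<n)))
    T+r : T + r ≡ p ^ k * suc R
    T+r = m+[n∸m]≡n (≤-trans (<⇒≤ T<p^k) (m≤m*n (p ^ k) (suc R)))
    q≡ : p ^ f ≡ p ^ k * p ^ n
    q≡ = trans (cong (p ^_) (sym k+n≡f)) (^-distribˡ-+-* p k n)
    regroup : ∀ a b t s → a * (1 + (t * b + s)) ≡ t * (a * b) + a * suc s
    regroup = solve-∀
    division : p ^ k * (1 + prefix p d f) ≡ T * suc (p ^ f) + r
    division = begin
      p ^ k * (1 + prefix p d f)          ≡⟨ cong (λ z → p ^ k * (1 + prefix p d z)) (sym k+n≡f) ⟩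
      p ^ k * (1 + prefix p d (k + n))    ≡⟨ cong (λ z → p ^ k * (1 + z)) (prefix-split p d k n) ⟩
      p ^ k * (1 + (T * p ^ n + R))       ≡⟨ regroup (p ^ k) (p ^ n) T R ⟩
      T * (p ^ k * p ^ n) + p ^ k * suc R ≡⟨ cong₂ (λ x y → T * x + y) (sym q≡) (sym T+r) ⟩
      T * p ^ f + (T + r)                 ≡⟨ sym (+-assoc (T * p ^ f) T r) ⟩
      T * p ^ f + T + r                   ≡⟨ cong (_+ r) (trans (+-comm (T * p ^ f) T) (sym (*-suc T (p ^ f)))) ⟩
      T * suc (p ^ f) + r                 ∎
      where open ≡-Reasoning
    0<r : 0 < r
    0<r = +-cancelˡ-≤ T 1 r (begin
      T + 1         ≡⟨ +-comm T 1 ⟩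
      suc T         ≤⟨ T<p^k ⟩
      p ^ k         ≤⟨ m≤m*n (p ^ k) (suc R) ⟩
      p ^ k * suc R ≡⟨ sym T+r ⟩
      T + r         ∎)
      where open ≤-Reasoning
    r≤q : r ≤ p ^ f
    r≤q = begin
      r             ≤⟨ m≤n+m r T ⟩
      T + r         ≡⟨ T+r ⟩
      p ^ k * suc R ≤⟨ *-monoʳ-≤ (p ^ k) R<p^n ⟩
      p ^ k * p ^ n ≡⟨ sym q≡ ⟩
      p ^ f         ∎
      where open ≤-Reasoning

module IntegerArithmetic where

  open import Data.Nat as ℕ using (ℕ; suc)
  open import Data.Integer hiding (suc)
  open import Data.Integer.Properties
  open import Data.Integer.DivMod using (a≡a%ℕn+[a/ℕn]*n; n%ℕd<d)
  import Data.Integer.Divisibility as Unsigned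
  open import Data.Integer.Divisibility.Signed using (divides; ∣ᵤ⇒∣)
  open import Data.Integer.Tactic.RingSolver using (solve-∀)
  open import Data.Product using (Σ; _×_; _,_)
  open import Data.Empty using (⊥-elim)
  open import Relation.Binary.PropositionalEquality

  -- Linear inequalities are proved by certificates: y - x (or y - x - 1) is exhibited, through a
  -- ring identity checked by the solver, as a sum of products of quantities known to be ≥ 0.

  ≥0-ℕ : ∀ n → 0ℤ ≤ + n
  ≥0-ℕ n = +≤+ ℕ.z≤n
  ≥0-+ : ∀ {x y} → 0ℤ ≤ x → 0ℤ ≤ y → 0ℤ ≤ x + y
  ≥0-+ = +-mono-≤
  ≥0-* : ∀ {x y} → 0ℤ ≤ x → 0ℤ ≤ y → 0ℤ ≤ x * y
  ≥0-* {+ m} {+ n} _ _ = subst (0ℤ ≤_) (pos-* m n) (≥0-ℕ (m ℕ.* n))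
  ≥0-below : ∀ {x y} → 0ℤ ≤ x → x < y → 0ℤ ≤ y
  ≥0-below 0≤x x<y = <⇒≤ (≤-<-trans 0≤x x<y)

  slack-≤ : ∀ {x y} → x ≤ y → 0ℤ ≤ y - x
  slack-≤ = i≤j⇒0≤j-i
  slack-< : ∀ {x y} → x < y → 0ℤ ≤ y - x - + 1
  slack-< {x} {y} x<y = subst (0ℤ ≤_) (shift x y) (i≤j⇒0≤j-i (i<j⇒suc[i]≤j x<y))
    where
    shift : ∀ x y → y - (+ 1 + x) ≡ y - x - + 1
    shift = solve-∀

  ≤-cert : ∀ {x y} d → 0ℤ ≤ d → y ≡ x + d → x ≤ y
  ≤-cert {x} d 0≤d refl = subst (_≤ x + d) (+-identityʳ x) (+-monoʳ-≤ x 0≤d)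
  <-cert : ∀ {x y} d → 0ℤ ≤ d → y ≡ x + d + + 1 → x < y
  <-cert {x} {y} d 0≤d y≡ = suc[i]≤j⇒i<j (≤-cert d 0≤d (trans y≡ (shift x d)))
    where
    shift : ∀ x d → x + d + + 1 ≡ + 1 + x + d
    shift = solve-∀

  cancel-< : ∀ {P₁ x y} → 0ℤ ≤ P₁ → (+ 1 + P₁) * x < (+ 1 + P₁) * y → x < y
  cancel-< {+ n} _ = *-cancelˡ-<-nonNeg (+ suc n)

  difference-sum : ∀ a b {c} → a - b ≡ c → a ≡ b + c
  difference-sum a b refl = split a b
    where
    split : ∀ a b → a ≡ b + (a - b)
    split = solve-∀

  cofactor : ∀ n z → + n Unsigned.∣ z → Σ ℤ λ c → z ≡ c * + n
  cofactor n z n∣z with ∣ᵤ⇒∣ {+ n} {z} n∣z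
  ... | divides c z≡ = c , z≡

  multiple-zero : ∀ {E} k → 0ℤ ≤ E → - E < k * E → k * E < E → k ≡ 0ℤ
  multiple-zero {+ n} k _ lower upper = between k
    (*-cancelʳ-<-nonNeg (+ n) (subst (_< k * + n) (sym (-1*i≡-i (+ n))) lower))
    (*-cancelʳ-<-nonNeg (+ n) (subst (k * + n <_) (sym (*-identityˡ (+ n))) upper))
    where
    between : ∀ j → -[1+ 0 ] < j → j < + 1 → j ≡ 0ℤ
    between (+ 0)    _        _                = refl
    between +[1+ _ ] _        (+<+ (ℕ.s≤s ()))
    between -[1+ _ ] (-<- ()) _

  small-multiple-zero : ∀ {R M} y → 0ℤ ≤ M → M < R → - M ≤ R * y → R * y ≤ M → y ≡ 0ℤ
  small-multiple-zero (+ 0) _ _ _ _ = refl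
  small-multiple-zero {R} {M} +[1+ n ] 0≤M M<R _ Ry≤M = ⊥-elim (<⇒≱
    (<-cert ((R - M - + 1) + R * + n) (≥0-+ (slack-< M<R) (≥0-* (≥0-below 0≤M M<R) (≥0-ℕ n)))
      (trans (cong (R *_) (pos-+ 1 n)) (above R M (+ n)))) Ry≤M)
    where
    above : ∀ R M n → R * (+ 1 + n) ≡ M + ((R - M - + 1) + R * n) + + 1
    above = solve-∀
  small-multiple-zero {R} {M} -[1+ n ] 0≤M M<R -M≤Ry _ = ⊥-elim (<⇒≱
    (<-cert ((R - M - + 1) + R * + n) (≥0-+ (slack-< M<R) (≥0-* (≥0-below 0≤M M<R) (≥0-ℕ n)))
      (trans (below R M (+ n)) (cong (λ z → R * - z + ((R - M - + 1) + R * + n) + + 1) (sym (pos-+ 1 n)))))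
    -M≤Ry)
    where
    below : ∀ R M n → - M ≡ R * - (+ 1 + n) + ((R - M - + 1) + R * n) + + 1
    below = solve-∀

  floor-unique : ∀ Q .{{_ : ℕ.NonZero Q}} z N r → z ≡ N * + Q + r → 0ℤ ≤ r → r < + Q → z /ℕ Q ≡ N
  floor-unique Q z N r z≡ 0≤r r<Q = i-j≡0⇒i≡j F N (multiple-zero (F - N) (≥0-ℕ Q)
    (<-cert (r + (+ Q - r′ - + 1)) (≥0-+ 0≤r (slack-< r′<Q)) (trans difference (lower r r′ (+ Q))))
    (<-cert (+ Q - r - + 1 + r′) (≥0-+ (slack-< r<Q) (≥0-ℕ (z %ℕ Q)))
      (trans (upper r r′ (+ Q)) (cong (λ w → w + (+ Q - r - + 1 + r′) + + 1) (sym difference)))))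
    where
    F r′ : ℤ
    F  = z /ℕ Q
    r′ = + (z %ℕ Q)
    r′<Q : r′ < + Q
    r′<Q = +<+ (n%ℕd<d z Q)
    difference : (F - N) * + Q ≡ r - r′
    difference = begin
      (F - N) * + Q                 ≡⟨ expand F N r′ (+ Q) ⟩
      (r′ + F * + Q) - r′ - N * + Q ≡⟨ cong (λ w → w - r′ - N * + Q) (trans (sym (a≡a%ℕn+[a/ℕn]*n z Q)) z≡) ⟩
      (N * + Q + r) - r′ - N * + Q  ≡⟨ collapse N r r′ (+ Q) ⟩
      r - r′                        ∎
      where
      open ≡-Reasoning
      expand : ∀ F N r′ Q → (F - N) * Q ≡ (r′ + F * Q) - r′ - N * Q
      expand = solve-∀
      collapse : ∀ N r r′ Q → (N * Q + r) - r′ - N * Q ≡ r - r′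
      collapse = solve-∀
    lower : ∀ r r′ Q → r - r′ ≡ - Q + (r + (Q - r′ - + 1)) + + 1
    lower = solve-∀
    upper : ∀ r r′ Q → Q ≡ (r - r′) + (Q - r - + 1 + r′) + + 1
    upper = solve-∀

  floor-complement : ∀ q z N r → z ≡ N * + suc q + r → 0ℤ < r → r ≤ + q →
    (+ q * z) /ℕ suc q ≡ z - + 1 - N
  floor-complement q z N r refl 0<r r≤q = floor-unique (suc q) (+ q * z) (z - + 1 - N) (+ suc q - r)
    (subst (λ Q → + q * (N * Q + r) ≡ (N * Q + r - + 1 - N) * Q + (Q - r)) (sym (pos-+ 1 q))
      (identity (+ q) N r))
    (≤-cert (+ 1 + (+ q - r)) (≥0-+ (≥0-ℕ 1) (slack-≤ r≤q)) (trans (cong (_- r) (pos-+ 1 q)) (shift+ (+ q) r)))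
    (<-cert (r - + 0 - + 1) (slack-< 0<r) (shift- (+ suc q) r))
    where
    identity : ∀ q N r → q * (N * (+ 1 + q) + r) ≡ (N * (+ 1 + q) + r - + 1 - N) * (+ 1 + q) + ((+ 1 + q) - r)
    identity = solve-∀
    shift+ : ∀ q r → + 1 + q - r ≡ + 0 + (+ 1 + (q - r))
    shift+ = solve-∀
    shift- : ∀ Q r → Q ≡ (Q - r) + (r - + 0 - + 1) + + 1
    shift- = solve-∀

  lift-step : ∀ {a₀ a₁ b₁} P E u b₀ c₀ c₁ → a₀ ≡ b₀ + c₀ * E → a₁ ≡ b₁ + c₁ * E → b₁ ≡ P * b₀ + u →
    a₁ ≡ P * a₀ + u + (c₁ - P * c₀) * E
  lift-step P E u b₀ c₀ c₁ refl refl refl = regroup P E u b₀ c₀ c₁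
    where
    regroup : ∀ P E u b₀ c₀ c₁ → P * b₀ + u + c₁ * E ≡ P * (b₀ + c₀ * E) + u + (c₁ - P * c₀) * E
    regroup = solve-∀

  pair-step : ∀ {P E a₁ b₁ u′} P₁ V u a₀ b₀ k k′ → P ≡ + 1 + P₁ → E ≡ P₁ * (V + + 1) → u′ ≡ P₁ - u →
    a₁ ≡ P * a₀ + u + k * E → b₁ ≡ P * b₀ + u′ + k′ * E →
    a₁ + b₁ - V ≡ P * (a₀ + b₀ - V) + (k + k′ + + 1) * E
  pair-step P₁ V u a₀ b₀ k k′ refl refl refl refl refl = regroup P₁ V a₀ b₀ u k k′
    where
    regroup : ∀ P₁ V a₀ b₀ u k k′ →
      (+ 1 + P₁) * a₀ + u + k * (P₁ * (V + + 1)) + ((+ 1 + P₁) * b₀ + (P₁ - u) + k′ * (P₁ * (V + + 1))) - V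
      ≡ (+ 1 + P₁) * (a₀ + b₀ - V) + (k + k′ + + 1) * (P₁ * (V + + 1))
    regroup = solve-∀

  -- The inequalities behind {X, X′} = {A, B}: a is the value in region A, b the value in region B,
  -- and ε the flag shared by the two conditions (in the application P = p, P₁ = p - 1, V = ν).
  record Straddle (P P₁ V a b ε : ℤ) : Set where
    field
      A-bound : P * a < V + P * ε
      B-lower : P₁ * V - P * ε < P * b
      B-upper : b ≤ V

  straddle-window : ∀ {P P₁ V a b ε} M → P ≡ + 1 + P₁ → V ≡ P * M → 0ℤ ≤ P₁ →
    Straddle P P₁ V a b ε → 0ℤ ≤ a → ε ≤ + 1 → - M ≤ a + b - V × a + b - V ≤ M
  straddle-window {P₁ = P₁} {a = a} {b} {ε} M refl refl 0≤P₁ s 0≤a ε≤1 =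
    ≤-cert (x - (- M - + 1) - + 1) (slack-< above) (from-below M x) ,
    ≤-cert (M + + 1 - x - + 1) (slack-< below) (from-above M x)
    where
    open Straddle s
    P x : ℤ
    P = + 1 + P₁
    x = a + b - P * M
    0≤P : 0ℤ ≤ P
    0≤P = ≥0-+ (≥0-ℕ 1) 0≤P₁
    -- p x < ν + p ε + p (b - ν) ≤ p (m + 1)
    below : x < M + + 1
    below = cancel-< 0≤P₁ (<-cert
      ((P * M + P * ε - P * a - + 1) + P * (P * M - b) + P * (+ 1 - ε))
      (≥0-+ (≥0-+ (slack-< A-bound) (≥0-* 0≤P (slack-≤ B-upper))) (≥0-* 0≤P (slack-≤ ε≤1)))
      (upper-identity P₁ M a b ε))
      where
      upper-identity : ∀ P₁ M a b ε → (+ 1 + P₁) * (M + + 1) ≡ (+ 1 + P₁) * (a + b - (+ 1 + P₁) * M)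
        + (((+ 1 + P₁) * M + (+ 1 + P₁) * ε - (+ 1 + P₁) * a - + 1)
           + (+ 1 + P₁) * ((+ 1 + P₁) * M - b) + (+ 1 + P₁) * (+ 1 - ε)) + + 1
      upper-identity = solve-∀
    -- p x > p a + (p - 1) ν - p ε - p ν ≥ -p (m + 1)
    above : - M - + 1 < x
    above = cancel-< 0≤P₁ (<-cert
      (P * a + (P * b - (P₁ * (P * M) - P * ε) - + 1) + P * (+ 1 - ε))
      (≥0-+ (≥0-+ (≥0-* 0≤P 0≤a) (slack-< B-lower)) (≥0-* 0≤P (slack-≤ ε≤1)))
      (lower-identity P₁ M a b ε))
      where
      lower-identity : ∀ P₁ M a b ε → (+ 1 + P₁) * (a + b - (+ 1 + P₁) * M) ≡ (+ 1 + P₁) * (- M - + 1)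
        + ((+ 1 + P₁) * a + ((+ 1 + P₁) * b - (P₁ * ((+ 1 + P₁) * M) - (+ 1 + P₁) * ε) - + 1)
           + (+ 1 + P₁) * (+ 1 - ε)) + + 1
      lower-identity = solve-∀
    from-below : ∀ M x → x ≡ - M + (x - (- M - + 1) - + 1)
    from-below = solve-∀
    from-above : ∀ M x → M ≡ x + (M + + 1 - x - + 1)
    from-above = solve-∀

  -- p ≥ 3: two values x₀, x₁ in the window [-m, m] with x₁ ≡ p x₀ (mod e) satisfy x₁ = p x₀,
  -- because |x₁ - p x₀| ≤ (p + 1) m < e = (p - 1)(p m + 1)
  doubling-large : ∀ {P P₁ V E x₀ x₁} P₃ M K → P ≡ + 3 + P₃ → P₁ ≡ + 2 + P₃ → V ≡ P * M →
    E ≡ P₁ * (V + + 1) → 0ℤ ≤ P₃ → 0ℤ ≤ M →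
    - M ≤ x₀ × x₀ ≤ M → - M ≤ x₁ × x₁ ≤ M → x₁ ≡ P * x₀ + K * E → x₁ ≡ P * x₀
  doubling-large {x₀ = x₀} P₃ M K refl refl refl refl 0≤P₃ 0≤M (x₀-low , x₀-high) (x₁-low , x₁-high) refl =
    trans (cong (λ k → P * x₀ + k * E) K≡0) (no-multiple (P * x₀) E)
    where
    P E : ℤ
    P = + 3 + P₃
    E = (+ 2 + P₃) * (P * M + + 1)
    -- E - (1 + P) M - 1, written as a visibly nonnegative quantity
    spare : ℤ
    spare = (P₃ * P₃ + + 4 * P₃ + + 2) * M + P₃ + + 1
    0≤spare : 0ℤ ≤ spare
    0≤spare = ≥0-+ (≥0-+ (≥0-* (≥0-+ (≥0-+ (≥0-* 0≤P₃ 0≤P₃) (≥0-* (≥0-ℕ 4) 0≤P₃)) (≥0-ℕ 2)) 0≤M) 0≤P₃) (≥0-ℕ 1)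
    0≤P : 0ℤ ≤ P
    0≤P = ≥0-+ (≥0-ℕ 3) 0≤P₃
    K≡0 : K ≡ 0ℤ
    K≡0 = multiple-zero K (≥0-* (≥0-+ (≥0-ℕ 2) 0≤P₃) (≥0-+ (≥0-* 0≤P 0≤M) (≥0-ℕ 1)))
      (<-cert (spare + (P * x₀ + K * E - - M) + P * (M - x₀))
        (≥0-+ (≥0-+ 0≤spare (slack-≤ x₁-low)) (≥0-* 0≤P (slack-≤ x₀-high))) (lower P₃ M x₀ K))
      (<-cert (spare + (M - (P * x₀ + K * E)) + P * (x₀ - - M))
        (≥0-+ (≥0-+ 0≤spare (slack-≤ x₁-high)) (≥0-* 0≤P (slack-≤ x₀-low))) (upper P₃ M x₀ K))
      where
      lower : ∀ P₃ M x₀ K → K * ((+ 2 + P₃) * ((+ 3 + P₃) * M + + 1)) ≡ - ((+ 2 + P₃) * ((+ 3 + P₃) * M + + 1))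
        + (((P₃ * P₃ + + 4 * P₃ + + 2) * M + P₃ + + 1)
           + ((+ 3 + P₃) * x₀ + K * ((+ 2 + P₃) * ((+ 3 + P₃) * M + + 1)) - - M) + (+ 3 + P₃) * (M - x₀)) + + 1
      lower = solve-∀
      upper : ∀ P₃ M x₀ K → (+ 2 + P₃) * ((+ 3 + P₃) * M + + 1) ≡ K * ((+ 2 + P₃) * ((+ 3 + P₃) * M + + 1))
        + (((P₃ * P₃ + + 4 * P₃ + + 2) * M + P₃ + + 1)
           + (M - ((+ 3 + P₃) * x₀ + K * ((+ 2 + P₃) * ((+ 3 + P₃) * M + + 1)))) + (+ 3 + P₃) * (x₀ - - M)) + + 1
      upper = solve-∀
    no-multiple : ∀ y E → y + 0ℤ * E ≡ y
    no-multiple = solve-∀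

  no-reduction : ∀ {E a a′ ε} M k → E ≡ + 2 * M + + 1 → 0ℤ ≤ a → a < M + ε → ε ≤ + 1 →
    a′ ≡ + 2 * a + (+ 1 - ε) + k * E → 0ℤ ≤ a′ × a′ < E → k ≡ 0ℤ
  no-reduction {a = a} {ε = ε} M k refl 0≤a a<M+ε ε≤1 refl (0≤a′ , a′<E) = multiple-zero k (≥0-below 0≤a′ a′<E)
    (<-cert (a′ + + 2 * (M + ε - a - + 1) + (+ 1 - ε))
      (≥0-+ (≥0-+ 0≤a′ (≥0-* (≥0-ℕ 2) (slack-< a<M+ε))) (slack-≤ ε≤1)) (lower M a ε k))
    (<-cert ((E - a′ - + 1) + + 2 * a + (+ 1 - ε))
      (≥0-+ (≥0-+ (slack-< a′<E) (≥0-* (≥0-ℕ 2) 0≤a)) (slack-≤ ε≤1)) (upper M a ε k))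
    where
    E a′ : ℤ
    E = + 2 * M + + 1
    a′ = + 2 * a + (+ 1 - ε) + k * E
    lower : ∀ M a ε k → k * (+ 2 * M + + 1) ≡ - (+ 2 * M + + 1)
      + ((+ 2 * a + (+ 1 - ε) + k * (+ 2 * M + + 1)) + + 2 * (M + ε - a - + 1) + (+ 1 - ε)) + + 1
    lower = solve-∀
    upper : ∀ M a ε k → + 2 * M + + 1 ≡ k * (+ 2 * M + + 1)
      + ((+ 2 * M + + 1 - (+ 2 * a + (+ 1 - ε) + k * (+ 2 * M + + 1)) - + 1) + + 2 * a + (+ 1 - ε)) + + 1
    upper = solve-∀

  one-reduction : ∀ {E b b′ ε} M k′ → E ≡ + 2 * M + + 1 → M - ε < b → b ≤ + 2 * M → ε ≤ + 1 →
    b′ ≡ + 2 * b + ε + k′ * E → 0ℤ ≤ b′ × b′ < E → k′ + + 1 ≡ 0ℤ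
  one-reduction {b = b} {ε = ε} M k′ refl M-ε<b b≤2M ε≤1 refl (0≤b′ , b′<E) =
    multiple-zero (k′ + + 1) (≥0-below 0≤b′ b′<E)
      (<-cert (b′ + + 2 * (+ 2 * M - b) + (+ 1 - ε))
        (≥0-+ (≥0-+ 0≤b′ (≥0-* (≥0-ℕ 2) (slack-≤ b≤2M))) (slack-≤ ε≤1)) (lower M b ε k′))
      (<-cert ((E - b′ - + 1) + + 2 * (b - (M - ε) - + 1) + (+ 1 - ε))
        (≥0-+ (≥0-+ (slack-< b′<E) (≥0-* (≥0-ℕ 2) (slack-< M-ε<b))) (slack-≤ ε≤1)) (upper M b ε k′))
    where
    E b′ : ℤ
    E = + 2 * M + + 1
    b′ = + 2 * b + ε + k′ * E
    lower : ∀ M b ε k′ → (k′ + + 1) * (+ 2 * M + + 1) ≡ - (+ 2 * M + + 1)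
      + ((+ 2 * b + ε + k′ * (+ 2 * M + + 1)) + + 2 * (+ 2 * M - b) + (+ 1 - ε)) + + 1
    lower = solve-∀
    upper : ∀ M b ε k′ → + 2 * M + + 1 ≡ (k′ + + 1) * (+ 2 * M + + 1)
      + ((+ 2 * M + + 1 - (+ 2 * b + ε + k′ * (+ 2 * M + + 1)) - + 1) + + 2 * (b - (M - ε) - + 1) + (+ 1 - ε)) + + 1
    upper = solve-∀

  -- p = 2: the window is too wide for doubling-large, and one uses the exact recursions instead.
  doubling-two : ∀ {P P₁ V E a b ε u w a′ b′} M k k′ → P ≡ + 2 → P₁ ≡ + 1 → V ≡ P * M →
    E ≡ P₁ * (V + + 1) → Straddle P P₁ V a b ε → 0ℤ ≤ a → ε ≤ + 1 → u ≡ P₁ - ε → w ≡ ε →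
    a′ ≡ P * a + u + k * E → 0ℤ ≤ a′ × a′ < E → b′ ≡ P * b + w + k′ * E → 0ℤ ≤ b′ × b′ < E →
    a′ + b′ - V ≡ P * (a + b - V)
  doubling-two {a = a} {b} {ε} M k k′ refl refl refl refl s 0≤a ε≤1 refl refl refl a′-range refl b′-range = begin
    a′ + b′ - V                                 ≡⟨ regroup M a b ε k k′ ⟩
    + 2 * (a + b - V) + k * E + (k′ + + 1) * E  ≡⟨ cong₂ (λ i j → + 2 * (a + b - V) + i * E + j * E) k≡0 k′+1≡0 ⟩
    + 2 * (a + b - V) + 0ℤ * E + 0ℤ * E         ≡⟨ drop (+ 2 * (a + b - V)) E ⟩
    + 2 * (a + b - V)                           ∎
    where
    open ≡-Reasoning
    open Straddle s
    V E a′ b′ : ℤ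
    V  = + 2 * M
    E  = + 1 * (V + + 1)
    a′ = + 2 * a + (+ 1 - ε) + k * E
    b′ = + 2 * b + ε + k′ * E
    E≡ : E ≡ + 2 * M + + 1
    E≡ = *-identityˡ (V + + 1)
    a<M+ε : a < M + ε
    a<M+ε = cancel-< (≥0-ℕ 1) (subst (+ 2 * a <_) (distrib M ε) A-bound)
      where
      distrib : ∀ M ε → + 2 * M + + 2 * ε ≡ (+ 1 + + 1) * (M + ε)
      distrib = solve-∀
    M-ε<b : M - ε < b
    M-ε<b = cancel-< (≥0-ℕ 1) (subst (_< + 2 * b) (distrib M ε) B-lower)
      where
      distrib : ∀ M ε → + 1 * (+ 2 * M) - + 2 * ε ≡ (+ 1 + + 1) * (M - ε)
      distrib = solve-∀
    k≡0 : k ≡ 0ℤ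
    k≡0 = no-reduction M k E≡ 0≤a a<M+ε ε≤1 refl a′-range
    k′+1≡0 : k′ + + 1 ≡ 0ℤ
    k′+1≡0 = one-reduction M k′ E≡ M-ε<b B-upper ε≤1 refl b′-range
    regroup : ∀ M a b ε k k′ →
      (+ 2 * a + (+ 1 - ε) + k * (+ 1 * (+ 2 * M + + 1))) + (+ 2 * b + ε + k′ * (+ 1 * (+ 2 * M + + 1))) - + 2 * M
      ≡ + 2 * (a + b - + 2 * M) + k * (+ 1 * (+ 2 * M + + 1)) + (k′ + + 1) * (+ 1 * (+ 2 * M + + 1))
    regroup = solve-∀
    drop : ∀ y E → y + 0ℤ * E + 0ℤ * E ≡ y
    drop = solve-∀

open import Data.Bool using (true; false; if_then_else_; T)
open import Data.Empty using (⊥-elim)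
open import Data.Nat as ℕ using (ℕ; zero; suc; _∸_; _^_)
import Data.Nat.Properties as ℕP
open import Data.Nat.DivMod using (m<n⇒m%n≡m; [m+n]%n≡m%n)
open import Data.Nat.Primality using (Prime; ¬prime[0]; ¬prime[1])
open import Data.Integer as ℤ hiding (suc; _^_)
open import Data.Integer.Properties
open import Data.Integer.Divisibility using (_∣_)
open import Data.Integer.Divisibility.Signed using (divides; ∣⇒∣ᵤ)
open import Data.Integer.Tactic.RingSolver using (solve-∀)
open import Data.Product using (Σ; _×_; _,_; proj₁; proj₂)
open import Data.Sum using (_⊎_; inj₁; inj₂)
open import Relation.Nullary using (¬_; yes; no; does)
open import Relation.Binary.PropositionalEquality

open NaturalArithmetic
open IntegerArithmetic

module Setting (p₂ f₁ : ℕ) where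

  p₁ p f q e m : ℕ
  p₁ = suc p₂
  p  = suc p₁
  f  = suc f₁
  q  = p ^ f
  e  = ee p f
  m  = geomSum p f₁

  P P₁ V E M : ℤ
  P  = + p
  P₁ = + p₁
  V  = + nu p f
  E  = + e
  M  = + m

  P≡ : P ≡ + 1 + P₁
  P≡ = pos-+ 1 p₁
  V≡ : V ≡ P * M
  V≡ = trans (cong +_ (nu≡ p f)) (pos-* p m)
  E≡ : E ≡ P₁ * (V + + 1)
  E≡ = trans (cong +_ (ee≡ p₁ f₁)) (trans (pos-* p₁ _) (cong (P₁ *_) (pos-+ (nu p f) 1)))
  q≡ : + q ≡ E + + 1
  q≡ = trans (cong +_ (sym (ℕP.m∸n+n≡m (ℕP.m^n>0 p f)))) (pos-+ e 1)
  M<p^f₁ : M < + (p ^ f₁)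
  M<p^f₁ = +<+ (geomSum<pow p₂ f₁)

  -- the region of a value a given the flags e₁ = ε_(i+f) and e₀ = ε_i: the body of X
  classify : ℤ → ℕ → ℕ → Region
  classify a e₁ e₀ =
    if does (P * a <? V + P * + e₁) then A
    else if does (P * a ≤? P₁ * V - P * + e₀) then AB
    else if does (a ≤? V) then B
    else Zero

  classify-A : ∀ a e₁ e₀ → classify a e₁ e₀ ≡ A → P * a < V + P * + e₁
  classify-A a e₁ e₀ isA with P * a <? V + P * + e₁ | P * a ≤? P₁ * V - P * + e₀ | a ≤? V
  classify-A a e₁ e₀ isA | yes lt | _     | _     = lt
  classify-A a e₁ e₀ ()  | no _   | yes _ | _
  classify-A a e₁ e₀ ()  | no _   | no _  | yes _
  classify-A a e₁ e₀ ()  | no _   | no _  | no _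
  classify-B : ∀ a e₁ e₀ → classify a e₁ e₀ ≡ B → P₁ * V - P * + e₀ < P * a × a ≤ V
  classify-B a e₁ e₀ isB with P * a <? V + P * + e₁ | P * a ≤? P₁ * V - P * + e₀ | a ≤? V
  classify-B a e₁ e₀ ()  | yes _ | _    | _
  classify-B a e₁ e₀ ()  | no _  | yes _ | _
  classify-B a e₁ e₀ isB | no _  | no ≰ | yes ≤V = ≰⇒> ≰ , ≤V
  classify-B a e₁ e₀ ()  | no _  | no _ | no _

  mod2f-small : ∀ i → i ℕ.< 2 ℕ.* f → mod2f f i ≡ i
  mod2f-small i i<2f = m<n⇒m%n≡m i<2f

  low<2f : ∀ {j} → j ℕ.< f → j ℕ.< 2 ℕ.* f
  low<2f j<f = ℕP.<-≤-trans j<f (ℕP.m≤m+n f (f ℕ.+ 0))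
  high<2f : ∀ {j} → j ℕ.< f → j ℕ.+ f ℕ.< 2 ℕ.* f
  high<2f j<f = ℕP.<-≤-trans (ℕP.+-monoˡ-< f j<f) (ℕP.≤-reflexive (cong (f ℕ.+_) (sym (ℕP.+-identityʳ f))))

  mod2f-wrap : ∀ j → j ℕ.< f → mod2f f (j ℕ.+ f ℕ.+ f) ≡ j
  mod2f-wrap j j<f = begin
    (j ℕ.+ f ℕ.+ f) ℕ.% (2 ℕ.* f) ≡⟨ cong (ℕ._% (2 ℕ.* f)) j+f+f≡ ⟩
    (j ℕ.+ 2 ℕ.* f) ℕ.% (2 ℕ.* f) ≡⟨ [m+n]%n≡m%n j (2 ℕ.* f) ⟩
    j ℕ.% (2 ℕ.* f)               ≡⟨ mod2f-small j (low<2f j<f) ⟩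
    j                             ∎
    where
    open ≡-Reasoning
    j+f+f≡ : j ℕ.+ f ℕ.+ f ≡ j ℕ.+ 2 ℕ.* f
    j+f+f≡ = trans (ℕP.+-assoc j f f) (cong (λ z → j ℕ.+ (f ℕ.+ z)) (sym (ℕP.+-identityʳ f)))

  module Digits (hd : ℕ → ℕ) (hd≤ : ∀ i → i ℕ.< f → hd i ℕ.≤ p₁) where

    -- h_k for k ∈ [0, 2f): the given digits, then their complements p - 1 - h_(k-f);
    -- by definition hExt p f hd i = digitAt (mod2f f i)
    digitAt : ℕ → ℕ
    digitAt k = if k ℕ.<ᵇ f then hd k else p₁ ∸ hd (k ∸ f)

    hExt-low : ∀ j → j ℕ.< f → hExt p f hd j ≡ hd j
    hExt-low j j<f rewrite mod2f-small j (low<2f j<f) with j ℕ.<ᵇ f | ℕP.<⇒<ᵇ j<f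
    ... | true | _ = refl
    hExt-high : ∀ j → j ℕ.< f → hExt p f hd (j ℕ.+ f) ≡ p₁ ∸ hd j
    hExt-high j j<f rewrite mod2f-small (j ℕ.+ f) (high<2f j<f) with (j ℕ.+ f) ℕ.<ᵇ f in lt
    ... | false = cong (λ i → p₁ ∸ hd i) (ℕP.m+n∸n≡m j f)
    ... | true  = ⊥-elim (ℕP.m+n≮n j f (ℕP.<ᵇ⇒< (j ℕ.+ f) f (subst T (sym lt) _)))

    hExt-complement : ∀ j → j ℕ.< f → + hExt p f hd (j ℕ.+ f) ≡ P₁ - + hExt p f hd j
    hExt-complement j j<f = begin
      + hExt p f hd (j ℕ.+ f) ≡⟨ cong +_ (hExt-high j j<f) ⟩
      + (p₁ ∸ hd j)           ≡⟨ sym (⊖-≥ (hd≤ j j<f)) ⟩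
      p₁ ⊖ hd j               ≡⟨ sym (m-n≡m⊖n p₁ (hd j)) ⟩
      P₁ - + hd j             ≡⟨ cong (λ d → P₁ - + d) (sym (hExt-low j j<f)) ⟩
      P₁ - + hExt p f hd j    ∎
      where open ≡-Reasoning

    eps-wrap : ∀ j → j ℕ.< f → eps p f hd (j ℕ.+ f ℕ.+ f) ≡ eps p f hd j
    eps-wrap j j<f = cong (λ n → if n ℕ.≡ᵇ p₁ then 1 else 0)
      (cong digitAt (trans (mod2f-wrap j j<f) (sym (mod2f-small j (low<2f j<f)))))

    eps≤1 : ∀ i → + eps p f hd i ≤ + 1
    eps≤1 i with hExt p f hd i ℕ.≡ᵇ p₁
    ... | true  = ≤-refl
    ... | false = +≤+ ℕ.z≤n

    eps-binary : p₂ ≡ 0 → ∀ i → hExt p f hd i ℕ.≤ p₁ → + hExt p f hd i ≡ + eps p f hd i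
    eps-binary p₂≡0 i h≤p₁ = cong +_ (sym (flag (hExt p f hd i) (cong suc p₂≡0) h≤p₁))
      where
      flag : ∀ {k} n → k ≡ 1 → n ℕ.≤ k → (if n ℕ.≡ᵇ k then 1 else 0) ≡ n
      flag zero          refl _ = refl
      flag (suc zero)    refl _ = refl
      flag (suc (suc n)) refl (ℕ.s≤s ())

    hExt-low≤ : ∀ j → j ℕ.< f → hExt p f hd j ℕ.≤ p₁
    hExt-low≤ j j<f = subst (ℕ._≤ p₁) (sym (hExt-low j j<f)) (hd≤ j j<f)
    hExt-high≤ : ∀ j → j ℕ.< f → hExt p f hd (j ℕ.+ f) ℕ.≤ p₁
    hExt-high≤ j j<f = subst (ℕ._≤ p₁) (sym (hExt-high j j<f)) (ℕP.m∸n≤m p₁ (hd j))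

    module Data (h γ γ′ : ℤ) (α : ℕ → ℤ)
      (h-digits : + suc q ∣ h - (+ 1 + + digitValue p f hd))
      (det      : + e ∣ h - (γ + γ′ + + 1 + V))
      (γ≢γ′     : ¬ (+ e ∣ γ - γ′))
      (α-spec   : ∀ i → i ℕ.< 2 ℕ.* f →
                    (0ℤ ≤ α i) × (α i < E) × (+ e ∣ α i - (floorTerm p f h i - + (p ^ i) * γ′)))
      where

      Q : ℤ
      Q = + suc q

      t : ℤ
      t = proj₁ (cofactor (suc q) (h - (+ 1 + + digitValue p f hd)) h-digits)
      h≡ : h ≡ (+ 1 + + prefix p hd f) + t * Q
      h≡ = subst (λ d → h ≡ (+ 1 + + d) + t * Q) (digitValue≡prefix p f hd)
             (difference-sum h (+ 1 + + digitValue p f hd) (proj₂ (cofactor (suc q) (h - (+ 1 + + digitValue p f hd)) h-digits)))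

      -- the quotient ⌊p^k h/(q + 1)⌋ predicted by the digits
      N : ℕ → ℤ
      N k = + (p ^ k) * t + + prefix p hd k

      N-step : ∀ k → N (suc k) ≡ P * N k + + hd k
      N-step k = begin
        + (p ℕ.* p ^ k) * t + + (p ℕ.* Tₖ ℕ.+ hd k) ≡⟨ cong₂ (λ a b → a * t + b) (pos-* p (p ^ k)) prefix-step ⟩
        P * + (p ^ k) * t + (P * + Tₖ + + hd k)     ≡⟨ regroup P (+ (p ^ k)) t (+ Tₖ) (+ hd k) ⟩
        P * N k + + hd k                            ∎
        where
        open ≡-Reasoning
        Tₖ : ℕ
        Tₖ = prefix p hd k
        prefix-step : + (p ℕ.* Tₖ ℕ.+ hd k) ≡ P * + Tₖ + + hd k
        prefix-step = trans (pos-+ (p ℕ.* Tₖ) (hd k)) (cong (_+ + hd k) (pos-* p Tₖ))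
        regroup : ∀ P a t T d → P * a * t + (P * T + d) ≡ P * (a * t + T) + d
        regroup = solve-∀

      record Division (k : ℕ) : Set where
        field
          r     : ℕ
          split : + (p ^ k) * h ≡ N k * Q + + r
          0<r   : 0 ℕ.< r
          r≤q   : r ℕ.≤ q

      division : ∀ k → k ℕ.≤ f → Division k
      division k k≤f with digit-division p₁ f hd hd≤ k (f ∸ k) (ℕP.m+[n∸m]≡n k≤f)
      ... | r , digits≡ , 0<r , r≤q = record { r = r ; split = split ; 0<r = 0<r ; r≤q = r≤q }
        where
        open ≡-Reasoning
        pk Tₖ D : ℤ
        pk = + (p ^ k)
        Tₖ = + prefix p hd k
        D  = + 1 + + prefix p hd f
        digitsℤ : pk * D ≡ Tₖ * Q + + r
        digitsℤ = begin
          pk * (+ 1 + + prefix p hd f)        ≡⟨ cong (pk *_) (sym (pos-+ 1 (prefix p hd f))) ⟩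
          pk * + (1 ℕ.+ prefix p hd f)        ≡⟨ sym (pos-* (p ^ k) _) ⟩
          + (p ^ k ℕ.* (1 ℕ.+ prefix p hd f)) ≡⟨ cong +_ digits≡ ⟩
          + (prefix p hd k ℕ.* suc q ℕ.+ r)   ≡⟨ trans (pos-+ _ r) (cong (_+ + r) (pos-* (prefix p hd k) (suc q))) ⟩
          Tₖ * Q + + r                        ∎
        split : pk * h ≡ N k * Q + + r
        split = begin
          pk * h                    ≡⟨ cong (pk *_) h≡ ⟩
          pk * (D + t * Q)          ≡⟨ expand pk D t Q ⟩
          pk * D + pk * t * Q       ≡⟨ cong (_+ pk * t * Q) digitsℤ ⟩
          Tₖ * Q + + r + pk * t * Q ≡⟨ collect pk t Q Tₖ (+ r) ⟩
          N k * Q + + r             ∎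
          where
          expand : ∀ pk D t Q → pk * (D + t * Q) ≡ pk * D + pk * t * Q
          expand = solve-∀
          collect : ∀ pk t Q T r → T * Q + r + pk * t * Q ≡ (pk * t + T) * Q + r
          collect = solve-∀

      floor-low : ∀ k → k ℕ.≤ f → floorTerm p f h k ≡ N k
      floor-low k k≤f = floor-unique (suc q) (+ (p ^ k) * h) (N k) (+ r) split (≥0-ℕ r) (+<+ (ℕ.s≤s r≤q))
        where open Division (division k k≤f)

      -- ⌊p^(k+f) h/(q + 1)⌋ = ⌊q p^k h/(q + 1)⌋ = p^k h - 1 - N_k, as the remainder of p^k h is nonzero
      floor-high : ∀ k → k ℕ.≤ f → floorTerm p f h (k ℕ.+ f) ≡ + (p ^ k) * h - + 1 - N k
      floor-high k k≤f =
        trans (cong (_/ℕ suc q) shift) (floor-complement q (+ (p ^ k) * h) (N k) (+ r) split (+<+ 0<r) (+≤+ r≤q))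
        where
        open Division (division k k≤f)
        commute : ∀ a b h → a * b * h ≡ b * (a * h)
        commute = solve-∀
        shift : + (p ^ (k ℕ.+ f)) * h ≡ + q * (+ (p ^ k) * h)
        shift = trans (cong (λ a → + a * h) (ℕP.^-distribˡ-+-* p k f))
                      (trans (cong (_* h) (pos-* (p ^ k) q)) (commute (+ (p ^ k)) (+ q) h))

      β : ℕ → ℤ
      β i = floorTerm p f h i - + (p ^ i) * γ′

      β-step-low : ∀ k → suc k ℕ.≤ f → β (suc k) ≡ P * β k + + hExt p f hd k
      β-step-low k k<f = begin
        floorTerm p f h (suc k) - + (p ℕ.* p ^ k) * γ′
          ≡⟨ cong₂ (λ a b → a - b * γ′) (trans (floor-low (suc k) k<f) (N-step k)) (pos-* p (p ^ k)) ⟩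
        P * N k + + hd k - P * + (p ^ k) * γ′
          ≡⟨ regroup P (N k) (+ hd k) (+ (p ^ k)) γ′ ⟩
        P * (N k - + (p ^ k) * γ′) + + hd k
          ≡⟨ cong₂ (λ a d → P * (a - + (p ^ k) * γ′) + + d) (sym (floor-low k (ℕP.<⇒≤ k<f))) (sym (hExt-low k k<f)) ⟩
        P * β k + + hExt p f hd k
          ∎
        where
        open ≡-Reasoning
        regroup : ∀ P N d a g → P * N + d - P * a * g ≡ P * (N - a * g) + d
        regroup = solve-∀

      β-step-high : ∀ k → suc k ℕ.≤ f → β (suc k ℕ.+ f) ≡ P * β (k ℕ.+ f) + + hExt p f hd (k ℕ.+ f)
      β-step-high k k<f = begin
        floorTerm p f h (suc k ℕ.+ f) - + (p ℕ.* p ^ (k ℕ.+ f)) * γ′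
          ≡⟨ cong₂ (λ a b → a - b * γ′) (floor-high (suc k) k<f) (pos-* p (p ^ (k ℕ.+ f))) ⟩
        + (p ℕ.* p ^ k) * h - + 1 - N (suc k) - P * pkf * γ′
          ≡⟨ cong₂ (λ a n → a * h - + 1 - n - P * pkf * γ′) (pos-* p (p ^ k)) (N-step k) ⟩
        P * pk * h - + 1 - (P * N k + + hd k) - P * pkf * γ′
          ≡⟨ regroup P₁ P≡ pk h (N k) (+ hd k) pkf γ′ ⟩
        P * (pk * h - + 1 - N k - pkf * γ′) + (P₁ - + hd k)
          ≡⟨ cong₂ (λ b d → P * (b - pkf * γ′) + d) (sym (floor-high k (ℕP.<⇒≤ k<f))) (sym complement) ⟩
        P * β (k ℕ.+ f) + + hExt p f hd (k ℕ.+ f)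
          ∎
        where
        open ≡-Reasoning
        pk pkf : ℤ
        pk  = + (p ^ k)
        pkf = + (p ^ (k ℕ.+ f))
        complement : + hExt p f hd (k ℕ.+ f) ≡ P₁ - + hd k
        complement = trans (hExt-complement k k<f) (cong (λ d → P₁ - + d) (hExt-low k k<f))
        regroup : ∀ {P} P₁ → P ≡ + 1 + P₁ → ∀ a h N d b g →
          P * a * h - + 1 - (P * N + d) - P * b * g ≡ P * (a * h - + 1 - N - b * g) + (P₁ - d)
        regroup P₁ refl = identity P₁
          where
          identity : ∀ P₁ a h N d b g → (+ 1 + P₁) * a * h - + 1 - ((+ 1 + P₁) * N + d) - (+ 1 + P₁) * b * g
            ≡ (+ 1 + P₁) * (a * h - + 1 - N - b * g) + (P₁ - d)
          identity = solve-∀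

      β-sum : β 0 + β f ≡ h - + 1 - (+ 1 + + q) * γ′
      β-sum = begin
        (floorTerm p f h 0 - + 1 * γ′) + (floorTerm p f h f - + q * γ′)
          ≡⟨ cong₂ (λ a b → (a - + 1 * γ′) + (b - + q * γ′)) (floor-low 0 ℕ.z≤n) (floor-high 0 ℕ.z≤n) ⟩
        (N 0 - + 1 * γ′) + (+ 1 * h - + 1 - N 0 - + q * γ′)
          ≡⟨ collect (N 0) h γ′ (+ q) ⟩
        h - + 1 - (+ 1 + + q) * γ′
          ∎
        where
        open ≡-Reasoning
        collect : ∀ n h g q → (n - + 1 * g) + (+ 1 * h - + 1 - n - q * g) ≡ h - + 1 - (+ 1 + q) * g
        collect = solve-∀

      α-range : ∀ i → i ℕ.< 2 ℕ.* f → 0ℤ ≤ α i × α i < E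
      α-range i i<2f = proj₁ (α-spec i i<2f) , proj₁ (proj₂ (α-spec i i<2f))
      α-rep : ∀ i → i ℕ.< 2 ℕ.* f → Σ ℤ λ c → α i ≡ β i + c * E
      α-rep i i<2f = proj₁ rep , difference-sum (α i) (β i) (proj₂ rep)
        where
        rep : Σ ℤ λ c → α i - β i ≡ c * E
        rep = cofactor e (α i - β i) (proj₂ (proj₂ (α-spec i i<2f)))

      α-step-low : ∀ j → suc j ℕ.< f → Σ ℤ λ k → α (suc j) ≡ P * α j + + hExt p f hd j + k * E
      α-step-low j j+1<f = proj₁ rep₁ - P * proj₁ rep₀ ,
        lift-step P E _ (β j) (proj₁ rep₀) (proj₁ rep₁) (proj₂ rep₀) (proj₂ rep₁) (β-step-low j (ℕP.<⇒≤ j+1<f))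
        where
        rep₀ : Σ ℤ λ c → α j ≡ β j + c * E
        rep₀ = α-rep j (low<2f (ℕP.<-trans (ℕP.n<1+n j) j+1<f))
        rep₁ : Σ ℤ λ c → α (suc j) ≡ β (suc j) + c * E
        rep₁ = α-rep (suc j) (low<2f j+1<f)

      α-step-high : ∀ j → suc j ℕ.< f →
        Σ ℤ λ k → α (suc j ℕ.+ f) ≡ P * α (j ℕ.+ f) + + hExt p f hd (j ℕ.+ f) + k * E
      α-step-high j j+1<f = proj₁ rep₁ - P * proj₁ rep₀ ,
        lift-step P E _ (β (j ℕ.+ f)) (proj₁ rep₀) (proj₁ rep₁) (proj₂ rep₀) (proj₂ rep₁) (β-step-high j (ℕP.<⇒≤ j+1<f))
        where
        rep₀ : Σ ℤ λ c → α (j ℕ.+ f) ≡ β (j ℕ.+ f) + c * E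
        rep₀ = α-rep (j ℕ.+ f) (high<2f (ℕP.<-trans (ℕP.n<1+n j) j+1<f))
        rep₁ : Σ ℤ λ c → α (suc j ℕ.+ f) ≡ β (suc j ℕ.+ f) + c * E
        rep₁ = α-rep (suc j ℕ.+ f) (high<2f j+1<f)

      x : ℕ → ℤ
      x j = α j + α (j ℕ.+ f) - V

      -- x_(j+1) ≡ p x_j (mod e), because h_j + h_(j+f) = p - 1 and e = (p - 1)(ν + 1)
      x-step : ∀ j → suc j ℕ.< f → Σ ℤ λ K → x (suc j) ≡ P * x j + K * E
      x-step j j+1<f = k + k′ + + 1 ,
        pair-step P₁ V (+ hExt p f hd j) (α j) (α (j ℕ.+ f)) k k′ P≡ E≡
          (hExt-complement j (ℕP.<-trans (ℕP.n<1+n j) j+1<f)) low high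
        where
        k k′ : ℤ
        k  = proj₁ (α-step-low j j+1<f)
        k′ = proj₁ (α-step-high j j+1<f)
        low : α (suc j) ≡ P * α j + + hExt p f hd j + k * E
        low = proj₂ (α-step-low j j+1<f)
        high : α (suc j ℕ.+ f) ≡ P * α (j ℕ.+ f) + + hExt p f hd (j ℕ.+ f) + k′ * E
        high = proj₂ (α-step-high j j+1<f)

      -- x₀ ≡ γ - γ′ (mod e), using β₀ + β_f, h ≡ γ + γ′ + 1 + ν and q ≡ 1 (mod e)
      x₀-congruence : Σ ℤ λ K → x 0 ≡ γ - γ′ + K * E
      x₀-congruence = c₀ + c_f + L - γ′ , (begin
        α 0 + α f - V
          ≡⟨ cong₂ (λ a b → a + b - V) α₀≡ α_f≡ ⟩
        (β 0 + c₀ * E) + (β f + c_f * E) - V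
          ≡⟨ regroup (β 0) (β f) c₀ c_f E V ⟩
        (β 0 + β f) + (c₀ + c_f) * E - V
          ≡⟨ cong (λ s → s + (c₀ + c_f) * E - V) β-sum ⟩
        h - + 1 - (+ 1 + + q) * γ′ + (c₀ + c_f) * E - V
          ≡⟨ cong₂ (λ h q → h - + 1 - (+ 1 + q) * γ′ + (c₀ + c_f) * E - V) (difference-sum h (γ + γ′ + + 1 + V) det≡) q≡ ⟩
        (γ + γ′ + + 1 + V + L * E) - + 1 - (+ 1 + (E + + 1)) * γ′ + (c₀ + c_f) * E - V
          ≡⟨ collect γ γ′ V L E c₀ c_f ⟩
        γ - γ′ + (c₀ + c_f + L - γ′) * E
          ∎)
        where
        open ≡-Reasoning
        c₀ c_f L : ℤ
        c₀  = proj₁ (α-rep 0 (low<2f (ℕ.s≤s ℕ.z≤n)))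
        c_f = proj₁ (α-rep f (high<2f (ℕ.s≤s ℕ.z≤n)))
        L   = proj₁ (cofactor e (h - (γ + γ′ + + 1 + V)) det)
        α₀≡ : α 0 ≡ β 0 + c₀ * E
        α₀≡ = proj₂ (α-rep 0 (low<2f (ℕ.s≤s ℕ.z≤n)))
        α_f≡ : α f ≡ β f + c_f * E
        α_f≡ = proj₂ (α-rep f (high<2f (ℕ.s≤s ℕ.z≤n)))
        det≡ : h - (γ + γ′ + + 1 + V) ≡ L * E
        det≡ = proj₂ (cofactor e (h - (γ + γ′ + + 1 + V)) det)
        regroup : ∀ b₀ b_f c₀ c_f E V → (b₀ + c₀ * E) + (b_f + c_f * E) - V ≡ (b₀ + b_f) + (c₀ + c_f) * E - V
        regroup = solve-∀
        collect : ∀ γ γ′ V L E c₀ c_f →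
          (γ + γ′ + + 1 + V + L * E) - + 1 - (+ 1 + (E + + 1)) * γ′ + (c₀ + c_f) * E - V
          ≡ γ - γ′ + (c₀ + c_f + L - γ′) * E
        collect = solve-∀

      x₀≢0 : x 0 ≢ 0ℤ
      x₀≢0 x₀≡0 = γ≢γ′ (∣⇒∣ᵤ (divides (- K) (begin
        γ - γ′                       ≡⟨ cancel (γ - γ′) K E ⟩
        (γ - γ′ + K * E) + (- K) * E ≡⟨ cong (_+ (- K) * E) (trans (sym x₀≡) x₀≡0) ⟩
        0ℤ + (- K) * E               ≡⟨ +-identityˡ _ ⟩
        (- K) * E                    ∎)))
        where
        open ≡-Reasoning
        K : ℤ
        K = proj₁ x₀-congruence
        x₀≡ : x 0 ≡ γ - γ′ + K * E
        x₀≡ = proj₂ x₀-congruence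
        cancel : ∀ a K E → a ≡ (a + K * E) + (- K) * E
        cancel = solve-∀

      Pattern : ℕ → Set
      Pattern j = PairIsAB (X p f hd α j) (X p f hd α (j ℕ.+ f))

      X-low : ∀ j → j ℕ.< f → X p f hd α j ≡ classify (α j) (eps p f hd (j ℕ.+ f)) (eps p f hd j)
      X-low j j<f = cong (λ i → classify (α i) (eps p f hd (j ℕ.+ f)) (eps p f hd j)) (mod2f-small j (low<2f j<f))
      X-high : ∀ j → j ℕ.< f →
        X p f hd α (j ℕ.+ f) ≡ classify (α (j ℕ.+ f)) (eps p f hd j) (eps p f hd (j ℕ.+ f))
      X-high j j<f = cong₂ (λ i ε → classify (α i) ε (eps p f hd (j ℕ.+ f)))
                       (mod2f-small (j ℕ.+ f) (high<2f j<f)) (eps-wrap j j<f)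

      straddle : ∀ j → j ℕ.< f → Pattern j →
        Straddle P P₁ V (α j) (α (j ℕ.+ f)) (+ eps p f hd (j ℕ.+ f))
        ⊎ Straddle P P₁ V (α (j ℕ.+ f)) (α j) (+ eps p f hd j)
      straddle j j<f (inj₁ (XA , XB)) = inj₁ (record
        { A-bound = classify-A (α j) ε-high ε-low (trans (sym (X-low j j<f)) XA)
        ; B-lower = proj₁ B-bounds
        ; B-upper = proj₂ B-bounds })
        where
        ε-low ε-high : ℕ
        ε-low  = eps p f hd j
        ε-high = eps p f hd (j ℕ.+ f)
        B-bounds : P₁ * V - P * + ε-high < P * α (j ℕ.+ f) × α (j ℕ.+ f) ≤ V
        B-bounds = classify-B (α (j ℕ.+ f)) ε-low ε-high (trans (sym (X-high j j<f)) XB)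
      straddle j j<f (inj₂ (XB , XA)) = inj₂ (record
        { A-bound = classify-A (α (j ℕ.+ f)) ε-low ε-high (trans (sym (X-high j j<f)) XA)
        ; B-lower = proj₁ B-bounds
        ; B-upper = proj₂ B-bounds })
        where
        ε-low ε-high : ℕ
        ε-low  = eps p f hd j
        ε-high = eps p f hd (j ℕ.+ f)
        B-bounds : P₁ * V - P * + ε-low < P * α j × α j ≤ V
        B-bounds = classify-B (α j) ε-high ε-low (trans (sym (X-low j j<f)) XB)

      window : ∀ j → j ℕ.< f → Pattern j → - M ≤ x j × x j ≤ M
      window j j<f pat with straddle j j<f pat
      ... | inj₁ s = straddle-window M P≡ V≡ (≥0-ℕ p₁) s (proj₁ (α-range j (low<2f j<f))) (eps≤1 (j ℕ.+ f))
      ... | inj₂ s = subst (λ y → - M ≤ y × y ≤ M) (cong (_- V) (+-comm (α (j ℕ.+ f)) (α j)))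
                       (straddle-window M P≡ V≡ (≥0-ℕ p₁) s (proj₁ (α-range (j ℕ.+ f) (high<2f j<f))) (eps≤1 j))

      doubling-p≥3 : ∀ p₃ → p₂ ≡ suc p₃ → ∀ j → suc j ℕ.< f → Pattern j → Pattern (suc j) →
        x (suc j) ≡ P * x j
      doubling-p≥3 p₃ p₂≡ j j+1<f pat pat′ = doubling-large (+ p₃) M (proj₁ (x-step j j+1<f))
        (trans (cong (λ n → + suc (suc n)) p₂≡) (pos-+ 3 p₃)) (trans (cong (λ n → + suc n) p₂≡) (pos-+ 2 p₃))
        V≡ E≡ (≥0-ℕ p₃) (≥0-ℕ m) (window j (ℕP.<-trans (ℕP.n<1+n j) j+1<f) pat) (window (suc j) j+1<f pat′)
        (proj₂ (x-step j j+1<f))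

      -- p = 2: the exact recursions of α_j and α_(j+f) force x_(j+1) = 2 x_j; the A-side value
      -- grows by the complement of the shared flag, the B-side value by the flag itself
      doubling-p≡2 : p₂ ≡ 0 → ∀ j → suc j ℕ.< f → Pattern j → x (suc j) ≡ P * x j
      doubling-p≡2 p₂≡0 j j+1<f pat = by-side (straddle j j<f pat) (α-step-low j j+1<f) (α-step-high j j+1<f)
        where
        j<f : j ℕ.< f
        j<f = ℕP.<-trans (ℕP.n<1+n j) j+1<f
        P≡2 : P ≡ + 2
        P≡2 = cong (λ n → + suc (suc n)) p₂≡0
        P₁≡1 : P₁ ≡ + 1
        P₁≡1 = cong (λ n → + suc n) p₂≡0
        h-low h-high ε-low ε-high : ℤ
        h-low  = + hExt p f hd j
        h-high = + hExt p f hd (j ℕ.+ f)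
        ε-low  = + eps p f hd j
        ε-high = + eps p f hd (j ℕ.+ f)
        bit-low : h-low ≡ ε-low
        bit-low = eps-binary p₂≡0 j (hExt-low≤ j j<f)
        bit-high : h-high ≡ ε-high
        bit-high = eps-binary p₂≡0 (j ℕ.+ f) (hExt-high≤ j j<f)
        complement′ : h-low ≡ P₁ - h-high
        complement′ = flip h-low P₁ (hExt-complement j j<f)
          where
          flip : ∀ {a} b c → a ≡ c - b → b ≡ c - a
          flip b c refl = swap b c
            where
            swap : ∀ b c → b ≡ c - (c - b)
            swap = solve-∀
        commute : ∀ a b V → a + b - V ≡ b + a - V
        commute = solve-∀
        by-side : Straddle P P₁ V (α j) (α (j ℕ.+ f)) ε-high ⊎ Straddle P P₁ V (α (j ℕ.+ f)) (α j) ε-low →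
          Σ ℤ (λ k → α (suc j) ≡ P * α j + h-low + k * E) →
          Σ ℤ (λ k → α (suc j ℕ.+ f) ≡ P * α (j ℕ.+ f) + h-high + k * E) →
          x (suc j) ≡ P * x j
        by-side (inj₁ s) (k , low) (k′ , high) =
          doubling-two M k k′ P≡2 P₁≡1 V≡ E≡ s (proj₁ (α-range j (low<2f j<f))) (eps≤1 (j ℕ.+ f))
            (trans complement′ (cong (λ u → P₁ - u) bit-high)) bit-high
            low (α-range (suc j) (low<2f j+1<f)) high (α-range (suc j ℕ.+ f) (high<2f j+1<f))
        by-side (inj₂ s) (k , low) (k′ , high) = trans (commute (α (suc j)) (α (suc j ℕ.+ f)) V)
          (trans (doubling-two M k′ k P≡2 P₁≡1 V≡ E≡ s (proj₁ (α-range (j ℕ.+ f) (high<2f j<f))) (eps≤1 j)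
                    (trans (hExt-complement j j<f) (cong (λ u → P₁ - u) bit-low)) bit-low
                    high (α-range (suc j ℕ.+ f) (high<2f j+1<f)) low (α-range (suc j) (low<2f j+1<f)))
                 (cong (P *_) (commute (α (j ℕ.+ f)) (α j) V)))

      doubling : ∀ j → suc j ℕ.< f → Pattern j → Pattern (suc j) → x (suc j) ≡ P * x j
      doubling j j+1<f pat pat′ = by-prime p₂ refl
        where
        by-prime : ∀ n → p₂ ≡ n → x (suc j) ≡ P * x j
        by-prime zero     p₂≡0 = doubling-p≡2 p₂≡0 j j+1<f pat
        by-prime (suc p₃) p₂≡  = doubling-p≥3 p₃ p₂≡ j j+1<f pat pat′

      geometric : (∀ i → i ℕ.< f → Pattern i) → ∀ j → j ℕ.< f → x j ≡ + (p ^ j) * x 0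
      geometric pats zero    _     = sym (*-identityˡ (x 0))
      geometric pats (suc j) j+1<f = begin
        x (suc j)             ≡⟨ doubling j j+1<f (pats j j<f) (pats (suc j) j+1<f) ⟩
        P * x j               ≡⟨ cong (P *_) (geometric pats j j<f) ⟩
        P * (+ (p ^ j) * x 0) ≡⟨ sym (*-assoc P (+ (p ^ j)) (x 0)) ⟩
        P * + (p ^ j) * x 0   ≡⟨ cong (_* x 0) (sym (pos-* p (p ^ j))) ⟩
        + (p ^ suc j) * x 0   ∎
        where
        open ≡-Reasoning
        j<f : j ℕ.< f
        j<f = ℕP.<-trans (ℕP.n<1+n j) j+1<f

      -- then p^(f-1) x₀ lies in [-m, m] with m < p^(f-1), so x₀ = 0: a contradiction
      no-pattern : ¬ (∀ i → i ℕ.< f → Pattern i)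
      no-pattern pats = x₀≢0 (small-multiple-zero (x 0) (≥0-ℕ m) M<p^f₁ (proj₁ bounds) (proj₂ bounds))
        where
        bounds : - M ≤ + (p ^ f₁) * x 0 × + (p ^ f₁) * x 0 ≤ M
        bounds = subst (λ y → - M ≤ y × y ≤ M) (geometric pats f₁ (ℕP.n<1+n f₁))
                   (window f₁ (ℕP.n<1+n f₁) (pats f₁ (ℕP.n<1+n f₁)))

-- Primes are at least 2, and f = 1 + f₁.
lemma2p1p6 :
    (p f : ℕ) → Prime p → 2 ℕ.≤ f →
    (h γ γ′ : ℤ) →
    ¬ (+ suc (qq p f) ∣ h) →
    ¬ (+ ee p f ∣ γ - γ′) →
    (+ ee p f ∣ h - (γ + γ′ + + 1 + + nu p f)) →
    (hd : ℕ → ℕ) →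
    (∀ i → i ℕ.< f → hd i ℕ.≤ p ∸ 1) →
    (+ suc (qq p f) ∣ h - (+ 1 + + digitValue p f hd)) →
    (α : ℕ → ℤ) →
    (∀ i → i ℕ.< 2 ℕ.* f →
      (+ 0 ℤ.≤ α i) × (α i ℤ.< + ee p f)
      × (+ ee p f ∣ α i - (floorTerm p f h i - + (p ^ i) * γ′))) →
    ¬ (∀ i → i ℕ.< f → PairIsAB (X p f hd α i) (X p f hd α (i ℕ.+ f)))
lemma2p1p6 0 _ p-prime = ⊥-elim (¬prime[0] p-prime)
lemma2p1p6 1 _ p-prime = ⊥-elim (¬prime[1] p-prime)
lemma2p1p6 (suc (suc p₂)) 0 _ ()
lemma2p1p6 (suc (suc p₂)) (suc f₁) _ _ h γ γ′ _ γ≢γ′ det hd hd≤ h-digits α α-spec =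
  Setting.Digits.Data.no-pattern p₂ f₁ hd hd≤ h γ γ′ α h-digits det γ≢γ′ α-spec
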